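{- Let $p$ be a prime and let $f:\mathbb{F}_p^n\to\mathbb{F}_p$ be a function of degree $d$. Define the $p$-fold tensor $T:(\mathbb{F}_p^n)^p\to\mathbb{F}_p$ by $T(X^1,\dots,X^p)=f(X^1+\dots+X^p)$. Then the slice rank of $T$ is at most $p\cdot\lvert\mathcal{M}_{\lfloor d/p\rfloor}(p,n)\rvert$.
   Context: A polynomial in $\mathbb{F}_p[x_1,\dots,x_n]$ is $p$-reduced if each variable has individual degree at most $p-1$; every function $\mathbb{F}_p^n\to\mathbb{F}_p$ is represented by a unique $p$-reduced polynomial, and the degree of the function is the total degree of that polynomial. $\mathcal{M}_k(p,n)$ is the set of monomials in $x_1,\dots,x_n$ with each variable of degree at most $p-1$ and total degree at most $k$. For a finite set $X$ and a field $\mathbb{F}$, a $k$-fold tensor is a function $T:X^k\to\mathbb{F}$; it has slice rank one if there exist $i\in[k]$ and functions $a:X\to\mathbb{F}$, $b:X^{k-1}\to\mathbb{F}$ with $T(x_1,\dots,x_k)=a(x_i)\,b(x_1,\dots,x_{i-1},x_{i+1},\dots,x_k)$ for all arguments; the slice rank of $T$ is the smallest $R$ such that $T$ is a sum of $R$ tensors of slice rank one (here $X=\mathbb{F}_p^n$, $k=p$, $\mathbb{F}=\mathbb{F}_p$). -}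

module Defs where

open import Data.Nat using (ℕ; zero; suc; _+_; _*_; _^_; _≤_; _≤?_; NonZero)
open import Data.Nat.DivMod using (_mod_)
open import Data.Nat.ListAction using (sum; product)
open import Data.Fin using (Fin; toℕ)
open import Data.List using (List; []; _∷_; map; concatMap; filter; length; allFin)
open import Data.Vec.Functional using (Vector; removeAt)
open import Data.Product using (Σ; _×_; _,_; ∃)
open import Relation.Binary.PropositionalEquality using (_≡_; _≢_)

Fp : ℕ → Set
Fp p = Fin p

FpVec : ℕ → ℕ → Set
FpVec p n = Fin n → Fin p

-- Enumeration of all vectors Fin n → Fin p (all points of F_p^n, and also
-- all exponent vectors with every exponent ≤ p-1).
allVecs : (p n : ℕ) → List (Fin n → Fin p)
allVecs p zero = (λ ()) ∷ []
allVecs p (suc n) =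
  concatMap (λ a → map (λ v → cons a v) (allVecs p n)) (allFin p)
  where
  cons : Fin p → (Fin n → Fin p) → Fin (suc n) → Fin p
  cons a v Fin.zero = a
  cons a v (Fin.suc i) = v i

_+F_ : {p : ℕ} .{{_ : NonZero p}} → Fin p → Fin p → Fin p
_+F_ {p} a b = (toℕ a + toℕ b) mod p

_*F_ : {p : ℕ} .{{_ : NonZero p}} → Fin p → Fin p → Fin p
_*F_ {p} a b = (toℕ a * toℕ b) mod p

sumF : {p : ℕ} .{{_ : NonZero p}} {k : ℕ} → (Fin k → Fin p) → Fin p
sumF {p} {k} g = sum (map (λ i → toℕ (g i)) (allFin k)) mod p

vecSum : {p n k : ℕ} .{{_ : NonZero p}} → (Fin k → FpVec p n) → FpVec p n
vecSum xs j = sumF (λ i → xs i j)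

totalDeg : {p n : ℕ} → (Fin n → Fin p) → ℕ
totalDeg {n = n} e = sum (map (λ i → toℕ (e i)) (allFin n))

-- A p-reduced polynomial in n variables: a coefficient for every exponent
-- vector e with each e_i ∈ {0,…,p-1}.
PRedPoly : ℕ → ℕ → Set
PRedPoly p n = (Fin n → Fin p) → Fin p

-- Evaluation of a p-reduced polynomial at a point of F_p^n
-- (computed in ℕ and reduced mod p, which is evaluation in F_p).
evalPoly : {p n : ℕ} .{{_ : NonZero p}} → PRedPoly p n → FpVec p n → Fin p
evalPoly {p} {n} c x =
  sum (map (λ e → toℕ (c e) * product (map (λ i → toℕ (x i) ^ toℕ (e i)) (allFin n)))
           (allVecs p n)) mod p

PolyHasDegree : {p n : ℕ} → PRedPoly p n → ℕ → Set
PolyHasDegree c d =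
  (∃ λ e → toℕ (c e) ≢ 0 × totalDeg e ≡ d) ×
  (∀ e → toℕ (c e) ≢ 0 → totalDeg e ≤ d)

-- A function F_p^n → F_p has degree d: its (unique) p-reduced representing
-- polynomial has total degree d.
HasDegree : {p n : ℕ} .{{_ : NonZero p}} → (FpVec p n → Fin p) → ℕ → Set
HasDegree {p} {n} f d =
  Σ (PRedPoly p n) λ c → (∀ x → evalPoly c x ≡ f x) × PolyHasDegree c d

-- M_k(p,n): monomials with each exponent ≤ p-1 and total degree ≤ k.
monomials : (k p n : ℕ) → List (Fin n → Fin p)
monomials k p n = filter (λ e → totalDeg e ≤? k) (allVecs p n)

numMonomials : (k p n : ℕ) → ℕ
numMonomials k p n = length (monomials k p n)

Tensor : (X F : Set) → ℕ → Set
Tensor X F k = (Fin k → X) → F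

SliceRankOne : {X : Set} {p m : ℕ} .{{_ : NonZero p}} → Tensor X (Fin p) (suc m) → Set
SliceRankOne {X} {p} {m} T =
  Σ (Fin (suc m)) λ i →
  Σ (X → Fin p) λ a →
  Σ ((Fin m → X) → Fin p) λ b →
    ∀ (xs : Fin (suc m) → X) → T xs ≡ (a (xs i) *F b (removeAt xs i))

SumOfSliceRankOne : {X : Set} {p m : ℕ} .{{_ : NonZero p}} →
                    Tensor X (Fin p) (suc m) → ℕ → Set
SumOfSliceRankOne {X} {p} {m} T R =
  Σ (Fin R → Tensor X (Fin p) (suc m)) λ ts →
    (∀ j → SliceRankOne (ts j)) ×
    (∀ xs → T xs ≡ sumF (λ j → ts j xs))

SliceRankAtMost : {X : Set} {p m : ℕ} .{{_ : NonZero p}} →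
                  Tensor X (Fin p) (suc m) → ℕ → Set
SliceRankAtMost T N = Σ ℕ λ R → R ≤ N × SumOfSliceRankOne T R

module Submission where

-- Lift everything to ℕ and reduce mod p only at the end.  Modulo p,
--   f(ΣX) ≡ Σ_e c_e ∏_i (Σ_j X^j_i)^{e_i},
-- and by the multinomial theorem (written as a sum over ordered
-- compositions, so no multinomial coefficients occur) each product expands
-- into split monomials ∏_j (X^j)^{E_j} whose column blocks E_j have degrees
-- summing to |e| ≤ d.  By pigeonhole some block has degree ≤ k = ⌊d/p⌋, so
-- it is one of the K = |M_k(p,n)| monomials m_r, and the split monomial is
-- m_r(X^j) times a function of the remaining arguments.  Grouping terms by
-- (j , r) writes T as a sum of p·K slices.

open import Defs
open import Algebra.Bundles using (Monoid)
import Algebra.Properties.Monoid.Sum as MonoidSum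
import Algebra.Properties.CommutativeMonoid.Sum as CommutativeMonoidSum
import Algebra.Properties.Semiring.Sum as SemiringSum
open import Data.Bool using (if_then_else_)
open import Data.Empty using (⊥-elim)
open import Data.Fin using (Fin; zero; suc; toℕ; fromℕ<; punchIn; combine; remQuot; _≟_)
open import Data.Fin.Properties using (suc-injective; toℕ-fromℕ<; toℕ<n; toℕ-injective; remQuot-combine)
open import Data.List using (List; []; _∷_; _++_; [_]; map; concatMap; length; lookup; allFin; tabulate)
import Data.List.Properties as List
open import Data.List.Membership.Propositional.Properties using (∈-allFin)
open import Data.List.Relation.Unary.All as All using (All)
import Data.List.Relation.Unary.All.Properties as All
open import Data.List.Relation.Unary.Any as Any using (Any)
import Data.List.Relation.Unary.Any.Properties as Any
open import Data.Nat using (ℕ; zero; suc; _+_; _*_; _^_; _≤_; _<_; _/_; _%_; _≤?_; NonZero)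
open import Data.Nat.DivMod using (_mod_; m≡m%n+[m/n]*n; m%n<n; %-distribˡ-+; %-distribˡ-*; m%n%n≡m%n)
open import Data.Nat.ListAction using (sum; product)
open import Data.Nat.ListAction.Properties using (sum-++)
open import Data.Nat.Primality using (Prime)
open import Data.Nat.Properties
  using ( +-*-semiring; +-0-monoid; *-1-monoid; *-1-commutativeMonoid; *-commutativeSemigroup
        ; +-comm; +-identityʳ; *-comm; *-zeroʳ; *-identityˡ; *-identityʳ; *-distribˡ-+; ^-distribˡ-+-*
        ; ≤-refl; ≤-<-trans; m≤m+n; +-monoˡ-≤; +-monoˡ-<; +-cancelˡ-<; ≰⇒>; module ≤-Reasoning )
  renaming (_≟_ to _≟ℕ_)
open import Algebra.Properties.CommutativeSemigroup *-commutativeSemigroup using (x∙yz≈y∙xz)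
open import Data.Product using (Σ; ∃-syntax; _,_; proj₁; proj₂)
open import Data.Sum using (inj₁; inj₂)
open import Data.Vec.Functional using (removeAt) renaming (_∷_ to _∷ᵥ_)
open import Function using (_∘_; id)
open import Relation.Binary.PropositionalEquality
  using (_≡_; _≢_; _≗_; refl; sym; trans; cong; cong₂; subst; module ≡-Reasoning)
open import Relation.Nullary using (yes; no; does)
open import Relation.Nullary.Decidable using (dec-true; dec-false)

module ∑ℕ = SemiringSum +-*-semiring
module ∏ℕ = CommutativeMonoidSum *-1-commutativeMonoid

∑ : ∀ {n} → (Fin n → ℕ) → ℕ
∑ = ∑ℕ.sum

∏ : ∀ {n} → (Fin n → ℕ) → ℕ
∏ = ∏ℕ.sum

module _ {a ℓ} (M : Monoid a ℓ) where
  open Monoid M using (Carrier; _≈_; ε; ∙-congˡ; ∙-congʳ; identityˡ; identityʳ)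
    renaming (trans to ≈-trans)
  open MonoidSum M using (sum-cong-≋; sum-replicate-zero) renaming (sum to ∑ᴹ)

  sum-single : ∀ {n} (t : Fin n → Carrier) (i : Fin n) →
               (∀ j → j ≢ i → t j ≈ ε) → ∑ᴹ t ≈ t i
  sum-single {suc n} t zero others =
    ≈-trans (∙-congˡ (≈-trans (sum-cong-≋ λ j → others (suc j) λ ()) (sum-replicate-zero n)))
            (identityʳ _)
  sum-single t (suc i) others =
    ≈-trans (∙-congʳ (others zero λ ()))
            (≈-trans (identityˡ _)
                     (sum-single (t ∘ suc) i λ j j≢i → others (suc j) (j≢i ∘ suc-injective)))

δ : ∀ {n} → Fin n → Fin n → ℕ
δ i j = if does (i ≟ j) then 1 else 0

δ-same : ∀ {n} (i : Fin n) → δ i i ≡ 1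
δ-same i = cong (if_then 1 else 0) (dec-true (i ≟ i) refl)

δ-diff : ∀ {n} {i j : Fin n} → i ≢ j → δ i j ≡ 0
δ-diff {i = i} {j} i≢j = cong (if_then 1 else 0) (dec-false (i ≟ j) i≢j)

sum-allFin : ∀ {n} (f : Fin n → ℕ) → sum (map f (allFin n)) ≡ ∑ f
sum-allFin f = trans (cong sum (List.map-tabulate id f)) (sum-tabulate f)
  where
  sum-tabulate : ∀ {n} (f : Fin n → ℕ) → sum (tabulate f) ≡ ∑ f
  sum-tabulate {zero} f = refl
  sum-tabulate {suc n} f = cong (f zero +_) (sum-tabulate (f ∘ suc))

product-allFin : ∀ {n} (f : Fin n → ℕ) → product (map f (allFin n)) ≡ ∏ f
product-allFin f = trans (cong product (List.map-tabulate id f)) (product-tabulate f)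
  where
  product-tabulate : ∀ {n} (f : Fin n → ℕ) → product (tabulate f) ≡ ∏ f
  product-tabulate {zero} f = refl
  product-tabulate {suc n} f = cong (f zero *_) (product-tabulate (f ∘ suc))

module _ {A : Set} where
  sum-map-cong : {f g : A → ℕ} → (∀ x → f x ≡ g x) → (l : List A) → sum (map f l) ≡ sum (map g l)
  sum-map-cong f≗g l = cong sum (List.map-cong f≗g l)

  sum-map-*ˡ : (c : ℕ) (f : A → ℕ) (l : List A) → sum (map (λ x → c * f x) l) ≡ c * sum (map f l)
  sum-map-*ˡ c f [] = sym (*-zeroʳ c)
  sum-map-*ˡ c f (x ∷ l) = trans (cong (c * f x +_) (sum-map-*ˡ c f l)) (sym (*-distribˡ-+ c (f x) _))

  sum-map-*ʳ : (c : ℕ) (f : A → ℕ) (l : List A) → sum (map (λ x → f x * c) l) ≡ sum (map f l) * c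
  sum-map-*ʳ c f l = trans (sum-map-cong (λ x → *-comm (f x) c) l) (trans (sum-map-*ˡ c f l) (*-comm c _))

  sum-concatMap : {B : Set} (f : B → ℕ) (g : A → List B) (l : List A) →
                  sum (map f (concatMap g l)) ≡ sum (map (λ x → sum (map f (g x))) l)
  sum-concatMap f g [] = refl
  sum-concatMap f g (x ∷ l) = begin
    sum (map f (g x ++ concatMap g l))          ≡⟨ cong sum (List.map-++ f (g x) _) ⟩
    sum (map f (g x) ++ map f (concatMap g l))  ≡⟨ sum-++ (map f (g x)) _ ⟩
    sum (map f (g x)) + sum (map f (concatMap g l))  ≡⟨ cong (sum (map f (g x)) +_) (sum-concatMap f g l) ⟩
    sum (map f (g x)) + sum (map (λ y → sum (map f (g y))) l) ∎
    where open ≡-Reasoning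

-- Congruence modulo p on ℕ and its compatibility with +, *, ^, list sums and
-- list products: the field operations of Defs are ℕ-arithmetic followed by
-- reduction mod p, so identities can be proved in ℕ and reduced at the end.
module Modular (p : ℕ) .{{_ : NonZero p}} where
  infix 4 _≈_
  record _≈_ (a b : ℕ) : Set where
    constructor same-residue
    field residue-≡ : a % p ≡ b % p

  ≈-refl : ∀ {a} → a ≈ a
  ≈-refl = same-residue refl

  ≡⇒≈ : ∀ {a b} → a ≡ b → a ≈ b
  ≡⇒≈ refl = ≈-refl

  ≈-sym : ∀ {a b} → a ≈ b → b ≈ a
  ≈-sym (same-residue eq) = same-residue (sym eq)

  ≈-trans : ∀ {a b c} → a ≈ b → b ≈ c → a ≈ c
  ≈-trans (same-residue eq₁) (same-residue eq₂) = same-residue (trans eq₁ eq₂)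

  ≈-+ : ∀ {a a′ b b′} → a ≈ a′ → b ≈ b′ → a + b ≈ a′ + b′
  ≈-+ {a} {a′} {b} {b′} (same-residue eq₁) (same-residue eq₂) = same-residue (begin
    (a + b) % p                ≡⟨ %-distribˡ-+ a b p ⟩
    (a % p + b % p) % p        ≡⟨ cong₂ (λ x y → (x + y) % p) eq₁ eq₂ ⟩
    (a′ % p + b′ % p) % p      ≡⟨ %-distribˡ-+ a′ b′ p ⟨
    (a′ + b′) % p              ∎)
    where open ≡-Reasoning

  ≈-* : ∀ {a a′ b b′} → a ≈ a′ → b ≈ b′ → a * b ≈ a′ * b′
  ≈-* {a} {a′} {b} {b′} (same-residue eq₁) (same-residue eq₂) = same-residue (begin
    (a * b) % p                ≡⟨ %-distribˡ-* a b p ⟩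
    (a % p * (b % p)) % p      ≡⟨ cong₂ (λ x y → (x * y) % p) eq₁ eq₂ ⟩
    (a′ % p * (b′ % p)) % p    ≡⟨ %-distribˡ-* a′ b′ p ⟨
    (a′ * b′) % p              ∎)
    where open ≡-Reasoning

  ≈-^ : ∀ {a b} (e : ℕ) → a ≈ b → a ^ e ≈ b ^ e
  ≈-^ zero    a≈b = ≈-refl
  ≈-^ (suc e) a≈b = ≈-* a≈b (≈-^ e a≈b)

  ≈-sum : {A : Set} {f g : A → ℕ} (l : List A) → (∀ x → f x ≈ g x) → sum (map f l) ≈ sum (map g l)
  ≈-sum []      f≈g = ≈-refl
  ≈-sum (x ∷ l) f≈g = ≈-+ (f≈g x) (≈-sum l f≈g)

  ≈-product : {A : Set} {f g : A → ℕ} (l : List A) → (∀ x → f x ≈ g x) →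
              product (map f l) ≈ product (map g l)
  ≈-product []      f≈g = ≈-refl
  ≈-product (x ∷ l) f≈g = ≈-* (f≈g x) (≈-product l f≈g)

  %-≈ : ∀ a → a % p ≈ a
  %-≈ a = same-residue (m%n%n≡m%n a p)

  toℕ-mod : ∀ a → toℕ (a mod p) ≡ a % p
  toℕ-mod a = toℕ-fromℕ< (m%n<n a p)

  mod-≈ : ∀ a → toℕ (a mod p) ≈ a
  mod-≈ a = ≈-trans (≡⇒≈ (toℕ-mod a)) (%-≈ a)

  ≈⇒mod-≡ : ∀ {a b} → a ≈ b → a mod p ≡ b mod p
  ≈⇒mod-≡ {a} {b} (same-residue eq) = toℕ-injective (trans (toℕ-mod a) (trans eq (sym (toℕ-mod b))))

-- Fix R "slices", the t-th acting on argument slot t through the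
-- fixed function a t.
module SliceSums {X : Set} {m R : ℕ} (slot : Fin R → Fin (suc m)) (a : Fin R → X → ℕ) where

  Cofactors : Set
  Cofactors = Fin R → (Fin m → X) → ℕ

  slice-term : Cofactors → (Fin (suc m) → X) → Fin R → ℕ
  slice-term b xs t = a t (xs (slot t)) * b t (removeAt xs (slot t))

  slices : Cofactors → (Fin (suc m) → X) → ℕ
  slices b xs = ∑ (slice-term b xs)

  SliceSum : ((Fin (suc m) → X) → ℕ) → Set
  SliceSum F = Σ Cofactors λ b → ∀ xs → F xs ≡ slices b xs

  sliceSum-resp : ∀ {F G} → (∀ xs → F xs ≡ G xs) → SliceSum F → SliceSum G
  sliceSum-resp F≗G (b , F≡) = b , λ xs → trans (sym (F≗G xs)) (F≡ xs)

  sliceSum-zero : SliceSum (λ _ → 0)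
  sliceSum-zero = (λ _ _ → 0) , λ xs →
    sym (trans (∑ℕ.sum-cong-≗ (λ t → *-zeroʳ (a t (xs (slot t))))) (∑ℕ.sum-replicate-zero R))

  sliceSum-+ : ∀ {F G} → SliceSum F → SliceSum G → SliceSum (λ xs → F xs + G xs)
  sliceSum-+ {F} {G} (b , F≡) (b′ , G≡) = (λ t ys → b t ys + b′ t ys) , λ xs → begin
    F xs + G xs                      ≡⟨ cong₂ _+_ (F≡ xs) (G≡ xs) ⟩
    slices b xs + slices b′ xs       ≡⟨ ∑ℕ.∑-distrib-+ (slice-term b xs) (slice-term b′ xs) ⟨
    ∑ (λ t → slice-term b xs t + slice-term b′ xs t)
      ≡⟨ ∑ℕ.sum-cong-≗ (λ t → *-distribˡ-+ (a t (xs (slot t))) _ _) ⟨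
    slices (λ t ys → b t ys + b′ t ys) xs ∎
    where open ≡-Reasoning

  sliceSum-scale : ∀ {F} (c : ℕ) → SliceSum F → SliceSum (λ xs → c * F xs)
  sliceSum-scale {F} c (b , F≡) = (λ t ys → c * b t ys) , λ xs → begin
    c * F xs                ≡⟨ cong (c *_) (F≡ xs) ⟩
    c * slices b xs         ≡⟨ ∑ℕ.*-distribˡ-sum c (slice-term b xs) ⟩
    ∑ (λ t → c * slice-term b xs t)
      ≡⟨ ∑ℕ.sum-cong-≗ (λ t → x∙yz≈y∙xz c (a t (xs (slot t))) _) ⟩
    slices (λ t ys → c * b t ys) xs ∎
    where open ≡-Reasoning

  sliceSum-list : {A : Set} (l : List A) (F : A → (Fin (suc m) → X) → ℕ) →
                  All (λ x → SliceSum (F x)) l → SliceSum (λ xs → sum (map (λ x → F x xs) l))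
  sliceSum-list []      F All.[]         = sliceSum-zero
  sliceSum-list (x ∷ l) F (Fx All.∷ Fl) = sliceSum-+ Fx (sliceSum-list l F Fl)

  -- A single slice a_{t₀}(x_{slot t₀}) · g(rest) is a slice sum: take b_t = δ_{t₀ t} g.
  sliceSum-slice : (t₀ : Fin R) (g : (Fin m → X) → ℕ) →
                   SliceSum (λ xs → a t₀ (xs (slot t₀)) * g (removeAt xs (slot t₀)))
  sliceSum-slice t₀ g = (λ t ys → δ t₀ t * g ys) , λ xs → sym (begin
    ∑ (λ t → a t (xs (slot t)) * (δ t₀ t * g (removeAt xs (slot t))))
      ≡⟨ sum-single +-0-monoid _ t₀ (λ t t≢t₀ → off-diagonal xs t (t≢t₀ ∘ sym)) ⟩
    a t₀ (xs (slot t₀)) * (δ t₀ t₀ * g (removeAt xs (slot t₀)))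
      ≡⟨ cong (λ δ₀ → a t₀ (xs (slot t₀)) * (δ₀ * g (removeAt xs (slot t₀)))) (δ-same t₀) ⟩
    a t₀ (xs (slot t₀)) * (1 * g (removeAt xs (slot t₀)))
      ≡⟨ cong (a t₀ (xs (slot t₀)) *_) (*-identityˡ _) ⟩
    a t₀ (xs (slot t₀)) * g (removeAt xs (slot t₀)) ∎)
    where
    open ≡-Reasoning
    off-diagonal : ∀ xs t → t₀ ≢ t → a t (xs (slot t)) * (δ t₀ t * g (removeAt xs (slot t))) ≡ 0
    off-diagonal xs t t₀≢t rewrite δ-diff t₀≢t = *-zeroʳ (a t (xs (slot t)))

  sliceSum⇒sliceRank : ∀ {p} .{{_ : NonZero p}} (T : Tensor X (Fin p) (suc m)) {F} →
                       SliceSum F → (∀ xs → T xs ≡ F xs mod p) → SliceRankAtMost T R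
  sliceSum⇒sliceRank {p} T {F} (b , F≡) T≡ = R , ≤-refl , tensor , rank-one , decomposition
    where
    open Modular p
    tensor : Fin R → Tensor X (Fin p) (suc m)
    tensor t xs = (a t (xs (slot t)) mod p) *F (b t (removeAt xs (slot t)) mod p)

    rank-one : ∀ t → SliceRankOne (tensor t)
    rank-one t = slot t , (λ x → a t x mod p) , (λ ys → b t ys mod p) , λ xs → refl

    term-≈ : ∀ xs t → slice-term b xs t ≈ toℕ (tensor t xs)
    term-≈ xs t = ≈-trans (≈-* (≈-sym (mod-≈ _)) (≈-sym (mod-≈ _)))
                          (≈-sym (≈-trans (≡⇒≈ (toℕ-mod _)) (%-≈ _)))

    decomposition : ∀ xs → T xs ≡ sumF (λ t → tensor t xs)
    decomposition xs = trans (T≡ xs) (≈⇒mod-≡ (≈-trans (≡⇒≈ F≡slices) (≈-sum (allFin R) (term-≈ xs))))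
      where
      F≡slices : F xs ≡ sum (map (slice-term b xs) (allFin R))
      F≡slices = trans (F≡ xs) (sym (sum-allFin (slice-term b xs)))

monomial : ∀ {n} → (Fin n → ℕ) → (Fin n → ℕ) → ℕ
monomial y E = ∏ (λ i → y i ^ E i)

choices : {A : Set} {n : ℕ} → (Fin n → List A) → List (Fin n → A)
choices {n = zero}  ls = [ (λ ()) ]
choices {n = suc n} ls = concatMap (λ x → map (x ∷ᵥ_) (choices (ls ∘ suc))) (ls zero)

sum-choices : {A : Set} {n : ℕ} (ls : Fin n → List A) (h : Fin n → A → ℕ) →
              sum (map (λ G → ∏ (λ i → h i (G i))) (choices ls)) ≡ ∏ (λ i → sum (map (h i) (ls i)))
sum-choices {n = zero}  ls h = refl
sum-choices {A} {suc n} ls h = begin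
  sum (map term (concatMap (λ x → map (x ∷ᵥ_) (choices (ls ∘ suc))) (ls zero)))
    ≡⟨ sum-concatMap term _ (ls zero) ⟩
  sum (map (λ x → sum (map term (map (x ∷ᵥ_) (choices (ls ∘ suc))))) (ls zero))
    ≡⟨ sum-map-cong expand-tail (ls zero) ⟩
  sum (map (λ x → h zero x * rest) (ls zero))
    ≡⟨ sum-map-*ʳ rest (h zero) (ls zero) ⟩
  sum (map (h zero) (ls zero)) * rest ∎
  where
  open ≡-Reasoning
  term : (Fin (suc n) → A) → ℕ
  term G = ∏ (λ i → h i (G i))
  rest : ℕ
  rest = ∏ (λ i → sum (map (h (suc i)) (ls (suc i))))
  expand-tail : ∀ x → sum (map term (map (x ∷ᵥ_) (choices (ls ∘ suc)))) ≡ h zero x * rest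
  expand-tail x = begin
    sum (map term (map (x ∷ᵥ_) (choices (ls ∘ suc))))
      ≡⟨ cong sum (List.map-∘ (choices (ls ∘ suc))) ⟨
    sum (map (λ G → h zero x * ∏ (λ i → h (suc i) (G i))) (choices (ls ∘ suc)))
      ≡⟨ sum-map-*ˡ (h zero x) _ (choices (ls ∘ suc)) ⟩
    h zero x * sum (map (λ G → ∏ (λ i → h (suc i) (G i))) (choices (ls ∘ suc)))
      ≡⟨ cong (h zero x *_) (sum-choices (ls ∘ suc) (h ∘ suc)) ⟩
    h zero x * rest ∎

All-choices : {A : Set} {n : ℕ} (P : Fin n → A → Set) (ls : Fin n → List A) →
              (∀ i → All (P i) (ls i)) → All (λ G → ∀ i → P i (G i)) (choices ls)
All-choices {n = zero}  P ls Pls = (λ ()) All.∷ All.[]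
All-choices {n = suc n} P ls Pls =
  All.concat⁺ (All.map⁺ (All.map (λ {x} Px → All.map⁺ (All.map (λ {G} PG → extend Px PG) tail-choices))
                                 (Pls zero)))
  where
  tail-choices : All (λ G → ∀ i → P (suc i) (G i)) (choices (ls ∘ suc))
  tail-choices = All-choices (P ∘ suc) (ls ∘ suc) (Pls ∘ suc)

  extend : ∀ {x G} → P zero x → (∀ i → P (suc i) (G i)) → ∀ i → P i ((x ∷ᵥ G) i)
  extend Px PG zero    = Px
  extend Px PG (suc i) = PG i

-- Ordered compositions of t into p parts, listed with multiplicity: one for
-- each word of length t over Fin p, recorded by its letter counts.
bump : ∀ {p} → (Fin p → ℕ) → Fin p → Fin p → ℕ
bump col j i = col i + δ j i

compositions : (p t : ℕ) → List (Fin p → ℕ)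
compositions p zero    = [ (λ _ → 0) ]
compositions p (suc t) = concatMap (λ col → map (bump col) (allFin p)) (compositions p t)

∑-bump : ∀ {p} (col : Fin p → ℕ) j → ∑ (bump col j) ≡ suc (∑ col)
∑-bump col j = begin
  ∑ (bump col j)      ≡⟨ ∑ℕ.∑-distrib-+ col (δ j) ⟩
  ∑ col + ∑ (δ j)
    ≡⟨ cong (∑ col +_) (sum-single +-0-monoid (δ j) j (λ i i≢j → δ-diff (i≢j ∘ sym))) ⟩
  ∑ col + δ j j       ≡⟨ cong (∑ col +_) (δ-same j) ⟩
  ∑ col + 1           ≡⟨ +-comm (∑ col) 1 ⟩
  suc (∑ col)         ∎
  where open ≡-Reasoning

monomial-bump : ∀ {p} (y col : Fin p → ℕ) j → monomial y (bump col j) ≡ y j * monomial y col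
monomial-bump y col j = begin
  ∏ (λ i → y i ^ (col i + δ j i))
    ≡⟨ ∏ℕ.sum-cong-≗ (λ i → ^-distribˡ-+-* (y i) (col i) (δ j i)) ⟩
  ∏ (λ i → y i ^ col i * y i ^ δ j i)
    ≡⟨ ∏ℕ.∑-distrib-+ (λ i → y i ^ col i) (λ i → y i ^ δ j i) ⟩
  monomial y col * ∏ (λ i → y i ^ δ j i)
    ≡⟨ cong (monomial y col *_) (sum-single *-1-monoid _ j (λ i i≢j → cong (y i ^_) (δ-diff (i≢j ∘ sym)))) ⟩
  monomial y col * y j ^ δ j j            ≡⟨ cong (λ e → monomial y col * y j ^ e) (δ-same j) ⟩
  monomial y col * (y j * 1)              ≡⟨ cong (monomial y col *_) (*-identityʳ (y j)) ⟩
  monomial y col * y j                    ≡⟨ *-comm (monomial y col) (y j) ⟩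
  y j * monomial y col                    ∎
  where open ≡-Reasoning

sum-compositions : ∀ {p} (y : Fin p → ℕ) t → sum (map (monomial y) (compositions p t)) ≡ ∑ y ^ t
sum-compositions {p} y zero = trans (+-identityʳ _) (∏ℕ.sum-replicate-zero p)
sum-compositions {p} y (suc t) = begin
  sum (map (monomial y) (concatMap (λ col → map (bump col) (allFin p)) (compositions p t)))
    ≡⟨ sum-concatMap (monomial y) _ (compositions p t) ⟩
  sum (map (λ col → sum (map (monomial y) (map (bump col) (allFin p)))) (compositions p t))
    ≡⟨ sum-map-cong one-more-letter (compositions p t) ⟩
  sum (map (λ col → ∑ y * monomial y col) (compositions p t))
    ≡⟨ sum-map-*ˡ (∑ y) (monomial y) (compositions p t) ⟩
  ∑ y * sum (map (monomial y) (compositions p t))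
    ≡⟨ cong (∑ y *_) (sum-compositions y t) ⟩
  ∑ y * ∑ y ^ t ∎
  where
  open ≡-Reasoning
  one-more-letter : ∀ col → sum (map (monomial y) (map (bump col) (allFin p))) ≡ ∑ y * monomial y col
  one-more-letter col = begin
    sum (map (monomial y) (map (bump col) (allFin p)))   ≡⟨ cong sum (List.map-∘ (allFin p)) ⟨
    sum (map (monomial y ∘ bump col) (allFin p))         ≡⟨ sum-allFin (monomial y ∘ bump col) ⟩
    ∑ (monomial y ∘ bump col)                            ≡⟨ ∑ℕ.sum-cong-≗ (monomial-bump y col) ⟩
    ∑ (λ j → y j * monomial y col)                       ≡⟨ ∑ℕ.*-distribʳ-sum (monomial y col) y ⟨
    ∑ y * monomial y col                                 ∎

All-compositions : ∀ {p} t → All (λ col → ∑ col ≡ t) (compositions p t)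
All-compositions {p} zero    = ∑ℕ.sum-replicate-zero p All.∷ All.[]
All-compositions {p} (suc t) =
  All.concat⁺ (All.map⁺ (All.map (λ {col} ∑col≡t → All.map⁺ (All.universal (bumped col ∑col≡t) (allFin p)))
                                 (All-compositions t)))
  where
  bumped : ∀ col → ∑ col ≡ t → ∀ j → ∑ (bump col j) ≡ suc t
  bumped col ∑col≡t j = trans (∑-bump col j) (cong suc ∑col≡t)

splits : (p : ℕ) {n : ℕ} → (Fin n → ℕ) → List (Fin n → Fin p → ℕ)
splits p e = choices (λ i → compositions p (e i))

sum-splits : ∀ {p n} (y : Fin n → Fin p → ℕ) (e : Fin n → ℕ) →
             sum (map (λ E → ∏ (λ i → monomial (y i) (E i))) (splits p e)) ≡ ∏ (λ i → ∑ (y i) ^ e i)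
sum-splits {p} y e = trans (sum-choices (λ i → compositions p (e i)) (λ i → monomial (y i)))
                           (∏ℕ.sum-cong-≗ (λ i → sum-compositions (y i) (e i)))

All-splits : ∀ {p n} (e : Fin n → ℕ) → All (λ E → ∀ i → ∑ (E i) ≡ e i) (splits p e)
All-splits e = All-choices (λ i col → ∑ col ≡ e i) _ (λ i → All-compositions (e i))

pigeonhole : ∀ {m} k (D : Fin m → ℕ) → ∑ D < m * suc k → ∃[ j ] D j ≤ k
pigeonhole {zero}  k D ()
pigeonhole {suc m} k D ∑D< with D zero ≤? k
... | yes D₀≤k = zero , D₀≤k
... | no  D₀≰k = let j , Dⱼ≤k = pigeonhole k (D ∘ suc) ∑tail< in suc j , Dⱼ≤k
  where
  -- D₀ ≥ k+1, so the remaining m numbers have sum < m(k+1).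
  ∑tail< : ∑ (D ∘ suc) < m * suc k
  ∑tail< = +-cancelˡ-< (suc k) _ _ (≤-<-trans (+-monoˡ-≤ (∑ (D ∘ suc)) (≰⇒> D₀≰k)) ∑D<)

<-*-suc-/ : ∀ d p .{{_ : NonZero p}} → d < p * suc (d / p)
<-*-suc-/ d p = begin-strict
  d                      ≡⟨ m≡m%n+[m/n]*n d p ⟩
  d % p + d / p * p      <⟨ +-monoˡ-< (d / p * p) (m%n<n d p) ⟩
  p + d / p * p          ≡⟨ *-comm (suc (d / p)) p ⟩
  p * suc (d / p)        ∎
  where open ≤-Reasoning

allVecs-complete : ∀ p n (v : Fin n → Fin p) → Any (_≗ v) (allVecs p n)
allVecs-complete p zero    v = Any.here (λ ())
allVecs-complete p (suc n) v =
  Any.concatMap⁺ _ (Any.map (λ { refl → Any.map⁺ (Any.map (λ w≗v → λ { zero → refl ; (suc i) → w≗v i })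
                                                     (allVecs-complete p n (v ∘ suc))) })
                        (∈-allFin (v zero)))

totalDeg-cong : ∀ {p n} {w v : Fin n → Fin p} → w ≗ v → totalDeg w ≡ totalDeg v
totalDeg-cong {n = n} w≗v = sum-map-cong (cong toℕ ∘ w≗v) (allFin n)

monomials-complete : ∀ k p n (v : Fin n → Fin p) → totalDeg v ≤ k →
                     ∃[ r ] lookup (monomials k p n) r ≗ v
monomials-complete k p n v deg≤k with Any.filter⁺ (λ e → totalDeg e ≤? k) (allVecs-complete p n v)
... | inj₁ v∈M   = Any.index v∈M , Any.lookup-index v∈M
... | inj₂ deg≰k = ⊥-elim (deg≰k (subst (_≤ k) (sym (totalDeg-cong (Any.lookup-result (allVecs-complete p n v))))
                                           deg≤k))

split-monomial-factor : ∀ {n q} (y E : Fin n → Fin (suc q) → ℕ) (j₀ : Fin (suc q)) →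
  ∏ (λ i → monomial (y i) (E i)) ≡
  monomial (λ i → y i j₀) (λ i → E i j₀) *
  ∏ (λ j′ → monomial (λ i → y i (punchIn j₀ j′)) (λ i → E i (punchIn j₀ j′)))
split-monomial-factor y E j₀ =
  trans (∏ℕ.∑-comm (λ i j → y i j ^ E i j))
        (∏ℕ.sum-remove {i = j₀} (λ j → monomial (λ i → y i j) (λ i → E i j)))

-- The slices are indexed by pairs
-- (j , r) ∈ Fin p × Fin K, encoded in Fin (p * K): slice (j , r) acts on the
-- j-th argument through the r-th monomial of M_k(p,n), k = ⌊d/p⌋.
module Decomposition (q n d : ℕ) where
  p : ℕ
  p = suc q

  k : ℕ
  k = d / p

  M : List (FpVec p n)
  M = monomials k p n

  K : ℕ
  K = length M

  slot : Fin (p * K) → Fin p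
  slot t = proj₁ (remQuot {p} K t)

  dictionary : Fin (p * K) → FpVec p n → ℕ
  dictionary t x = monomial (toℕ ∘ x) (toℕ ∘ lookup M (proj₂ (remQuot {p} K t)))

  open SliceSums slot dictionary
  open Modular p

  coordinates : (Fin p → FpVec p n) → Fin n → Fin p → ℕ
  coordinates X i j = toℕ (X j i)

  IsSplitOf : (Fin n → Fin p → ℕ) → FpVec p n → Set
  IsSplitOf E e = ∀ i → ∑ (E i) ≡ toℕ (e i)

  -- If the rows of E are compositions of an exponent vector e of degree ≤ d,
  -- then some column j₀ of E has degree ≤ k (pigeonhole) and entries < p, so it
  -- is the exponent vector of a monomial r₀ of M.
  column-in-M : (e : FpVec p n) → totalDeg e ≤ d → (E : Fin n → Fin p → ℕ) → IsSplitOf E e →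
                ∃[ j₀ ] ∃[ r₀ ] ∀ i → toℕ (lookup M r₀ i) ≡ E i j₀
  column-in-M e deg≤d E rows = j₀ , r₀ , λ i → trans (cong toℕ (r₀-is-column i)) (toℕ-fromℕ< (entry< i))
    where
    column-degree : Fin p → ℕ
    column-degree j = ∑ (λ i → E i j)

    ∑column-degree : ∑ column-degree ≡ totalDeg e
    ∑column-degree = trans (sym (∑ℕ.∑-comm E)) (trans (∑ℕ.sum-cong-≗ rows) (sym (sum-allFin (toℕ ∘ e))))

    small-column : ∃[ j ] column-degree j ≤ k
    small-column = pigeonhole k column-degree
      (≤-<-trans (subst (_≤ d) (sym ∑column-degree) deg≤d) (<-*-suc-/ d p))

    j₀ : Fin p
    j₀ = proj₁ small-column

    entry< : ∀ i → E i j₀ < p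
    entry< i = ≤-<-trans (subst (E i j₀ ≤_) (sym (∑ℕ.sum-remove {i = j₀} (E i))) (m≤m+n _ _))
                         (subst (_< p) (sym (rows i)) (toℕ<n (e i)))

    column : FpVec p n
    column i = fromℕ< (entry< i)

    column-deg : totalDeg column ≤ k
    column-deg = subst (_≤ k) (sym (trans (sum-allFin (toℕ ∘ column))
                                          (∑ℕ.sum-cong-≗ (λ i → toℕ-fromℕ< (entry< i)))))
                       (proj₂ small-column)

    r₀ : Fin K
    r₀ = proj₁ (monomials-complete k p n column column-deg)

    r₀-is-column : lookup M r₀ ≗ column
    r₀-is-column = proj₂ (monomials-complete k p n column column-deg)

  split-monomial-slice : (e : FpVec p n) → totalDeg e ≤ d → (E : Fin n → Fin p → ℕ) → IsSplitOf E e →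
                         SliceSum (λ X → ∏ (λ i → monomial (coordinates X i) (E i)))
  split-monomial-slice e deg≤d E rows with column-in-M e deg≤d E rows
  ... | j₀ , r₀ , r₀≡column = sliceSum-resp factor (sliceSum-slice t₀ rest)
    where
    t₀ : Fin (p * K)
    t₀ = combine j₀ r₀

    rest : (Fin q → FpVec p n) → ℕ
    rest Y = ∏ (λ j′ → monomial (toℕ ∘ Y j′) (λ i → E i (punchIn j₀ j′)))

    slot-t₀ : slot t₀ ≡ j₀
    slot-t₀ = cong proj₁ (remQuot-combine {k = K} j₀ r₀)

    dictionary-t₀ : ∀ x → dictionary t₀ x ≡ monomial (toℕ ∘ x) (λ i → E i j₀)
    dictionary-t₀ x = trans (cong (λ r → monomial (toℕ ∘ x) (toℕ ∘ lookup M r))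
                                  (cong proj₂ (remQuot-combine {k = K} j₀ r₀)))
                            (∏ℕ.sum-cong-≗ (λ i → cong (toℕ (x i) ^_) (r₀≡column i)))

    factor : ∀ X → dictionary t₀ (X (slot t₀)) * rest (removeAt X (slot t₀)) ≡
                   ∏ (λ i → monomial (coordinates X i) (E i))
    factor X = begin
      dictionary t₀ (X (slot t₀)) * rest (removeAt X (slot t₀))
        ≡⟨ cong (λ j → dictionary t₀ (X j) * rest (removeAt X j)) slot-t₀ ⟩
      dictionary t₀ (X j₀) * rest (removeAt X j₀)
        ≡⟨ cong (_* rest (removeAt X j₀)) (dictionary-t₀ (X j₀)) ⟩
      monomial (toℕ ∘ X j₀) (λ i → E i j₀) * rest (removeAt X j₀)
        ≡⟨ split-monomial-factor (coordinates X) E j₀ ⟨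
      ∏ (λ i → monomial (coordinates X i) (E i)) ∎
      where open ≡-Reasoning

  power-of-sums : FpVec p n → (Fin p → FpVec p n) → ℕ
  power-of-sums e X = product (map (λ i → sum (map (λ j → toℕ (X j i)) (allFin p)) ^ toℕ (e i)) (allFin n))

  power-of-sums-expansion : ∀ e X →
    sum (map (λ E → ∏ (λ i → monomial (coordinates X i) (E i))) (splits p (toℕ ∘ e))) ≡ power-of-sums e X
  power-of-sums-expansion e X = trans (sum-splits (coordinates X) (toℕ ∘ e)) (sym (begin
    power-of-sums e X
      ≡⟨ product-allFin (λ i → sum (map (coordinates X i) (allFin p)) ^ toℕ (e i)) ⟩
    ∏ (λ i → sum (map (coordinates X i) (allFin p)) ^ toℕ (e i))
      ≡⟨ ∏ℕ.sum-cong-≗ (λ i → cong (_^ toℕ (e i)) (sum-allFin (coordinates X i))) ⟩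
    ∏ (λ i → ∑ (coordinates X i) ^ toℕ (e i))  ∎))
    where open ≡-Reasoning

  lifted : PRedPoly p n → (Fin p → FpVec p n) → ℕ
  lifted c X = sum (map (λ e → toℕ (c e) * power-of-sums e X) (allVecs p n))

  evalPoly-vecSum : ∀ c X → evalPoly c (vecSum X) ≡ lifted c X mod p
  evalPoly-vecSum c X = ≈⇒mod-≡ (≈-sum (allVecs p n) λ e →
    ≈-* (≈-refl {toℕ (c e)}) (≈-product (allFin n) λ i →
      ≈-^ (toℕ (e i)) (mod-≈ (sum (map (λ j → toℕ (X j i)) (allFin p))))))

  DegreeAtMost : PRedPoly p n → Set
  DegreeAtMost c = ∀ e → toℕ (c e) ≢ 0 → totalDeg e ≤ d

  -- Each term c_e ∏_i (Σ_j X^j_i)^{e_i} of the lift is a slice sum: it vanishes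
  -- if c_e = 0, and otherwise |e| ≤ d and it expands into split monomials,
  -- each of which is a single slice.
  term-sliceSum : ∀ c → DegreeAtMost c → ∀ e → SliceSum (λ X → toℕ (c e) * power-of-sums e X)
  term-sliceSum c deg e with toℕ (c e) ≟ℕ 0
  ... | yes cₑ≡0 = sliceSum-resp (λ X → cong (_* power-of-sums e X) (sym cₑ≡0)) sliceSum-zero
  ... | no  cₑ≢0 = sliceSum-scale (toℕ (c e)) (sliceSum-resp (power-of-sums-expansion e)
          (sliceSum-list (splits p (toℕ ∘ e)) (λ E X → ∏ (λ i → monomial (coordinates X i) (E i)))
            (All.map (λ {E} → split-monomial-slice e (deg e cₑ≢0) E) (All-splits (toℕ ∘ e)))))

  lifted-sliceSum : ∀ c → DegreeAtMost c → SliceSum (lifted c)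
  lifted-sliceSum c deg = sliceSum-list (allVecs p n) _ (All.universal (term-sliceSum c deg) (allVecs p n))

  sliceRank-bound : ∀ c → DegreeAtMost c → (f : FpVec p n → Fin p) → (∀ x → evalPoly c x ≡ f x) →
                    SliceRankAtMost {FpVec p n} {p} {q} (λ X → f (vecSum X)) (p * K)
  sliceRank-bound c deg f eval = sliceSum⇒sliceRank (λ X → f (vecSum X)) (lifted-sliceSum c deg)
    (λ X → trans (sym (eval (vecSum X))) (evalPoly-vecSum c X))

lemma3 : (q n d : ℕ) → Prime (suc q) →
    (f : FpVec (suc q) n → Fin (suc q)) → HasDegree f d →
    SliceRankAtMost {FpVec (suc q) n} {suc q} {q}
      (λ X → f (vecSum X))
      (suc q * numMonomials (d / suc q) (suc q) n)
lemma3 q n d _ f (c , eval , _ , deg≤d) = Decomposition.sliceRank-bound q n d c deg≤d f eval
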